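{- Let $\Gamma$ be a finite, connected, simple, undirected graph with at least one edge, $n$ vertices and $m$ edges, $G$ a group, and $s_1,s_2\in Z(G)$ with $s_1^2=s_2^2=1_G$. Let $q$ be the number of edges of $L(\Gamma)$. For every $H\in\mathcal H_\Gamma$, $g\in G^m$ and $f\in G^n$: (1) $L(H\underline g)=\underline g^{\,*}L(H)$; (2) $L(\underline f^{\,*}H)=L(H)\underline{f'}$ for some $f'\in G^q$; (3) $\Psi_L(H)=s_1s_2\,\Psi(L(H))$, i.e. $\Psi_L(H)(e_i,e_j)=s_1s_2\,\Psi(L(H))(e_i,e_j)$ for all adjacent $e_i,e_j$ in $L(\Gamma)$.
   Context: Fix orders $V_\Gamma=\{v_1,\dots,v_n\}$, $E_\Gamma=\{e_1,\dots,e_m\}$; write $v_i\in e_j$ if $v_i$ is an endpoint of $e_j$, and $e_i\cap e_j$ for the common endpoint of distinct edges sharing a vertex. The line graph $L(\Gamma)$ has vertex set $E_\Gamma$ (ordered $e_1,\dots,e_m$), with $e_i\sim e_j$ iff they share an endpoint; fix an order $E_1,\dots,E_q$ of its edges and for $E_k=\{e_i,e_j\}$ put $v(E_k)=e_i\cap e_j$. $\mathbb CG$ is the complex group algebra with involution $(\sum f_xx)^*=\sum\overline{f_x}x^{ -1}$, $(A^*)_{i,j}=(A_{j,i})^*$. For any graph $\Lambda$ with ordered vertices $w_1,\dots,w_p$ and edges $\epsilon_1,\dots,\epsilon_r$, a $G$-phase of $\Lambda$ is $H\in M_{p\times r}(\mathbb CG)$ with $H_{i,j}\in G$ if $w_i\in\epsilon_j$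 and $0$ otherwise; $\mathcal H_\Lambda$ is their set, and $\Psi(H)$ is the gain function on $\Lambda$ (map on ordered pairs of adjacent vertices into $G$, inverting under reversal) with $\Psi(H)(w_i,w_j)=s_1H_{i,k}H_{j,k}^{ -1}$ for $\epsilon_k=\{w_i,w_j\}$. For $H\in\mathcal H_\Gamma$, $\Psi_L(H)$ is the gain function on $L(\Gamma)$ with $\Psi_L(H)(e_i,e_j)=s_2H_{k,i}^{ -1}H_{k,j}$ for $v_k=e_i\cap e_j$. The map $L\colon\mathcal H_\Gamma\to\mathcal H_{L(\Gamma)}$ is $L(H)_{i,k}=0$ if $e_i\notin E_k$ and $L(H)_{i,k}=H_{l,i}^{ -1}$ if $e_i\in E_k$ and $v(E_k)=v_l$. For $g\in G^k$, $\underline g=\mathrm{diag}(g_1,\dots,g_k)$. -}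

module Defs where

open import Level using (Level)
open import Data.Nat using (ℕ; _≥_)
open import Data.Fin using (Fin; _≟_)
open import Data.Product using (_×_; _,_; proj₁; proj₂; ∃; ∃-syntax; swap)
open import Data.Sum using (_⊎_)
open import Data.Bool using (if_then_else_; _∨_)
open import Relation.Nullary using (¬_)
open import Relation.Nullary.Decidable using (⌊_⌋)
open import Relation.Binary.PropositionalEquality using (_≡_; _≢_)
open import Relation.Binary.Construct.Closure.ReflexiveTransitive using (Star)
open import Algebra.Bundles using (Group)

Ends : ℕ → ℕ → Set
Ends p r = Fin r → Fin p × Fin p

Inc : ∀ {p r} → Ends p r → Fin p → Fin r → Set
Inc ends v k = v ≡ proj₁ (ends k) ⊎ v ≡ proj₂ (ends k)

Joins : ∀ {p r} → Ends p r → Fin r → Fin p → Fin p → Set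
Joins ends k u v = ends k ≡ (u , v) ⊎ ends k ≡ (v , u)

Adj : ∀ {p r} → Ends p r → Fin p → Fin p → Set
Adj ends u v = ∃[ k ] Joins ends k u v

record SimpleGraph (p r : ℕ) : Set where
  field
    ends     : Ends p r
    loopless : ∀ k → proj₁ (ends k) ≢ proj₂ (ends k)
    noMulti  : ∀ j k → (ends j ≡ ends k ⊎ ends j ≡ swap (ends k)) → j ≡ k

Connected : ∀ {p r} → SimpleGraph p r → Set
Connected Γ = ∀ u v → Star (Adj (SimpleGraph.ends Γ)) u v

EdgesAdj : ∀ {n m} → Ends n m → Fin m → Fin m → Set
EdgesAdj ends a b = a ≢ b × ∃[ v ] (Inc ends v a × Inc ends v b)

-- An ordering E_1,…,E_q of the edges of the line graph L(Γ):
-- every E_k is a pair of adjacent edges of Γ, every unordered pair of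
-- adjacent edges occurs, and it occurs exactly once.
record LineGraphEnum {n m} (Γ : SimpleGraph n m) (q : ℕ) (LE : Ends m q) : Set where
  open SimpleGraph Γ
  field
    valid : ∀ k → EdgesAdj ends (proj₁ (LE k)) (proj₂ (LE k))
    onto  : ∀ a b → EdgesAdj ends a b → ∃[ k ] Joins LE k a b
    inj   : ∀ j k → (LE j ≡ LE k ⊎ LE j ≡ swap (LE k)) → j ≡ k

-- e_a ∩ e_b : the common endpoint of two (adjacent, distinct) edges
commonV : ∀ {n m} → Ends n m → Fin m → Fin m → Fin n
commonV ends a b with ends a | ends b
... | (x , y) | (z , w) = if ⌊ x ≟ z ⌋ ∨ ⌊ x ≟ w ⌋ then x else y

-- A G-phase of a graph with p vertices and r edges is a
-- p×r matrix over ℂG whose (i,k) entry lies in G if w_i ∈ ε_k and is 0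
-- otherwise.  We represent it by a function  Fin p → Fin r → G ; only
-- the entries at incident positions are meaningful (the others stand
-- for the zero entries), and equality of phases is equality in G at
-- all incident positions.

module GPhase {c ℓ : Level} (G : Group c ℓ) where
  open Group G public renaming (Carrier to C)

  Phase : ℕ → ℕ → Set c
  Phase p r = Fin p → Fin r → C

  PhaseEq : ∀ {p r} → Ends p r → Phase p r → Phase p r → Set ℓ
  PhaseEq ends A B = ∀ i k → Inc ends i k → A i k ≈ B i k

  _·diag_ : ∀ {p r} → Phase p r → (Fin r → C) → Phase p r
  (H ·diag g) i k = H i k ∙ g k

  -- diag(f)^* * H  =  diag(f_1⁻¹,…,f_p⁻¹) * H
  diag*_·_ : ∀ {p r} → (Fin p → C) → Phase p r → Phase p r
  (diag* f · H) i k = (f i) ⁻¹ ∙ H i k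

  Ψ : ∀ {p r} → C → Phase p r → Fin p → Fin p → Fin r → C
  Ψ s₁ H i j k = s₁ ∙ H i k ∙ (H j k) ⁻¹

  ΨL : ∀ {n m} → Ends n m → C → Phase n m → Fin m → Fin m → C
  ΨL ends s₂ H i j = s₂ ∙ (H (commonV ends i j) i) ⁻¹ ∙ H (commonV ends i j) j

  Lmap : ∀ {n m q} → Ends n m → Ends m q → Phase n m → Phase m q
  Lmap ends LE H i k = (H (commonV ends (proj₁ (LE k)) (proj₂ (LE k))) i) ⁻¹

  Central : C → Set (c Level.⊔ ℓ)
  Central s = ∀ x → s ∙ x ≈ x ∙ s

module Submission where

open import Defs
open import Level using (Level)
open import Data.Nat using (ℕ; _≥_)
open import Data.Fin using (Fin; _≟_)
open import Data.Product using (_×_; _,_; proj₁; proj₂; ∃-syntax; swap)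
open import Data.Sum using (_⊎_; inj₁; inj₂)
open import Data.Bool using (if_then_else_; _∨_)
open import Data.Empty using (⊥-elim)
open import Relation.Nullary using (yes; no)
open import Relation.Nullary.Decidable using (⌊_⌋)
open import Relation.Binary.PropositionalEquality as ≡
  using (_≡_; _≢_; refl; cong; cong₂)
open import Algebra.Bundles using (Group)
import Algebra.Properties.Group as GroupProperties
import Relation.Binary.Reasoning.Setoid as SetoidReasoning

-- (1) and (2) are the entrywise identity (x y)⁻¹ = y⁻¹ x⁻¹ in G.
-- For (3), both sides are computed at the same vertex e_i ∩ e_j = v(E_k);
-- when E_k is listed as (e_j , e_i) this needs e_i ∩ e_j = e_j ∩ e_i, which
-- holds because two distinct edges of a simple graph share at most one
-- endpoint.  What is left is s₂ a b = s₁ s₂ (s₁ a (b⁻¹)⁻¹), which uses only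
-- s₁² = 1 and centrality of s₂.

_∈ₚ_ : ∀ {n} → Fin n → Fin n × Fin n → Set
v ∈ₚ P = v ≡ proj₁ P ⊎ v ≡ proj₂ P

-- commonV ends a b reduces to commonEnd (ends a) (ends b).
commonEnd : ∀ {n} → Fin n × Fin n → Fin n × Fin n → Fin n
commonEnd (x , y) (z , w) = if ⌊ x ≟ z ⌋ ∨ ⌊ x ≟ w ⌋ then x else y

commonEnd-∈ : ∀ {n} (P Q : Fin n × Fin n) {v} → v ∈ₚ P → v ∈ₚ Q →
  commonEnd P Q ∈ₚ P × commonEnd P Q ∈ₚ Q
commonEnd-∈ (x , y) (z , w) vP vQ with x ≟ z
... | yes x≡z = inj₁ refl , inj₁ x≡z
... | no x≢z with x ≟ w
...   | yes x≡w = inj₁ refl , inj₂ x≡w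
...   | no x≢w = inj₂ refl , y∈Q vP vQ
  where
  y∈Q : _ ∈ₚ (x , y) → _ ∈ₚ (z , w) → y ∈ₚ (z , w)
  y∈Q (inj₁ refl) (inj₁ x≡z) = ⊥-elim (x≢z x≡z)
  y∈Q (inj₁ refl) (inj₂ x≡w) = ⊥-elim (x≢w x≡w)
  y∈Q (inj₂ refl) v∈Q        = v∈Q

∈ₚ-both⇒pair : ∀ {n} (P : Fin n × Fin n) {u v} → u ≢ v → u ∈ₚ P → v ∈ₚ P →
  P ≡ (u , v) ⊎ P ≡ (v , u)
∈ₚ-both⇒pair P u≢v (inj₁ u≡x) (inj₁ v≡x) = ⊥-elim (u≢v (≡.trans u≡x (≡.sym v≡x)))
∈ₚ-both⇒pair P u≢v (inj₁ u≡x) (inj₂ v≡y) = inj₁ (≡.sym (cong₂ _,_ u≡x v≡y))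
∈ₚ-both⇒pair P u≢v (inj₂ u≡y) (inj₁ v≡x) = inj₂ (≡.sym (cong₂ _,_ v≡x u≡y))
∈ₚ-both⇒pair P u≢v (inj₂ u≡y) (inj₂ v≡y) = ⊥-elim (u≢v (≡.trans u≡y (≡.sym v≡y)))

module _ {n m} (Γ : SimpleGraph n m) where
  open SimpleGraph Γ

  shared-endpoint-unique : ∀ {a b} → a ≢ b → ∀ {u v} →
    Inc ends u a → Inc ends u b → Inc ends v a → Inc ends v b → u ≡ v
  shared-endpoint-unique {a} {b} a≢b {u} {v} ua ub va vb with u ≟ v
  ... | yes u≡v = u≡v
  ... | no u≢v  = ⊥-elim (a≢b (noMulti a b
        (sameEdge (∈ₚ-both⇒pair (ends a) u≢v ua va) (∈ₚ-both⇒pair (ends b) u≢v ub vb))))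
    where
    sameEdge : ends a ≡ (u , v) ⊎ ends a ≡ (v , u) → ends b ≡ (u , v) ⊎ ends b ≡ (v , u) →
      ends a ≡ ends b ⊎ ends a ≡ swap (ends b)
    sameEdge (inj₁ p) (inj₁ q) = inj₁ (≡.trans p (≡.sym q))
    sameEdge (inj₁ p) (inj₂ q) = inj₂ (≡.trans p (cong swap (≡.sym q)))
    sameEdge (inj₂ p) (inj₁ q) = inj₂ (≡.trans p (cong swap (≡.sym q)))
    sameEdge (inj₂ p) (inj₂ q) = inj₁ (≡.trans p (≡.sym q))

  commonV-comm : ∀ {a b} → EdgesAdj ends a b → commonV ends a b ≡ commonV ends b a
  commonV-comm {a} {b} (a≢b , v , va , vb) =
    shared-endpoint-unique a≢b (proj₁ ab) (proj₂ ab) (proj₂ ba) (proj₁ ba)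
    where
    ab = commonEnd-∈ (ends a) (ends b) va vb
    ba = commonEnd-∈ (ends b) (ends a) vb va

edgeVertex : ∀ {n m q} → Ends n m → Ends m q → Fin q → Fin n
edgeVertex ends LE k = commonV ends (proj₁ (LE k)) (proj₂ (LE k))

edgeVertex-joins : ∀ {n m q} (Γ : SimpleGraph n m) {LE : Ends m q} →
  LineGraphEnum Γ q LE → ∀ {k i j} → Joins LE k i j →
  edgeVertex (SimpleGraph.ends Γ) LE k ≡ commonV (SimpleGraph.ends Γ) i j
edgeVertex-joins Γ LG {k} (inj₁ LEk≡ij) = cong (λ P → commonV (SimpleGraph.ends Γ) (proj₁ P) (proj₂ P)) LEk≡ij
edgeVertex-joins Γ LG {k} (inj₂ LEk≡ji) with LineGraphEnum.valid LG k
... | adj rewrite LEk≡ji = commonV-comm Γ adj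

module _ {c ℓ : Level} (G : Group c ℓ) where
  open GPhase G
  open GroupProperties G
  open SetoidReasoning setoid

  Lmap-·diag : ∀ {n m q} (ends : Ends n m) (LE : Ends m q) H g →
    PhaseEq LE (Lmap ends LE (H ·diag g)) (diag* g · Lmap ends LE H)
  Lmap-·diag ends LE H g i k _ = ⁻¹-anti-homo-∙ _ _

  Lmap-diag* : ∀ {n m q} (ends : Ends n m) (LE : Ends m q) H f →
    PhaseEq LE (Lmap ends LE (diag* f · H)) (Lmap ends LE H ·diag (λ k → f (edgeVertex ends LE k)))
  Lmap-diag* ends LE H f i k _ = trans (⁻¹-anti-homo-∙ _ _) (∙-congˡ (⁻¹-involutive _))

  involution-cancel : ∀ {s₁ s₂} → Central s₂ → s₁ ∙ s₁ ≈ ε → ∀ x → s₁ ∙ s₂ ∙ (s₁ ∙ x) ≈ s₂ ∙ x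
  involution-cancel {s₁} {s₂} s₂-central s₁²≈ε x = begin
    s₁ ∙ s₂ ∙ (s₁ ∙ x)   ≈⟨ assoc s₁ s₂ _ ⟩
    s₁ ∙ (s₂ ∙ (s₁ ∙ x)) ≈⟨ ∙-congˡ (sym (assoc s₂ s₁ x)) ⟩
    s₁ ∙ (s₂ ∙ s₁ ∙ x)   ≈⟨ ∙-congˡ (∙-congʳ (s₂-central s₁)) ⟩
    s₁ ∙ (s₁ ∙ s₂ ∙ x)   ≈⟨ ∙-congˡ (assoc s₁ s₂ x) ⟩
    s₁ ∙ (s₁ ∙ (s₂ ∙ x)) ≈⟨ sym (assoc s₁ s₁ _) ⟩
    s₁ ∙ s₁ ∙ (s₂ ∙ x)   ≈⟨ ∙-congʳ s₁²≈ε ⟩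
    ε ∙ (s₂ ∙ x)         ≈⟨ identityˡ _ ⟩
    s₂ ∙ x               ∎

  ΨL≈Ψ-Lmap : ∀ {n m q} (Γ : SimpleGraph n m) {LE : Ends m q} → LineGraphEnum Γ q LE →
    ∀ {s₁ s₂} → Central s₂ → s₁ ∙ s₁ ≈ ε → ∀ H {i j k} → Joins LE k i j →
    ΨL (SimpleGraph.ends Γ) s₂ H i j ≈ s₁ ∙ s₂ ∙ Ψ s₁ (Lmap (SimpleGraph.ends Γ) LE H) i j k
  ΨL≈Ψ-Lmap Γ {LE} LG {s₁} {s₂} s₂-central s₁²≈ε H {i} {j} {k} k-joins = begin
    s₂ ∙ H l i ⁻¹ ∙ H l j                  ≡⟨ cong (λ v → s₂ ∙ H v i ⁻¹ ∙ H v j) l≡vE ⟩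
    s₂ ∙ H v i ⁻¹ ∙ H v j                  ≈⟨ assoc s₂ _ _ ⟩
    s₂ ∙ (H v i ⁻¹ ∙ H v j)                ≈⟨ involution-cancel s₂-central s₁²≈ε _ ⟨
    s₁ ∙ s₂ ∙ (s₁ ∙ (H v i ⁻¹ ∙ H v j))    ≈⟨ ∙-congˡ (sym (assoc s₁ _ _)) ⟩
    s₁ ∙ s₂ ∙ (s₁ ∙ H v i ⁻¹ ∙ H v j)      ≈⟨ ∙-congˡ (∙-congˡ (⁻¹-involutive _)) ⟨
    s₁ ∙ s₂ ∙ (s₁ ∙ H v i ⁻¹ ∙ H v j ⁻¹ ⁻¹) ∎
    where
    l = commonV (SimpleGraph.ends Γ) i j
    v = edgeVertex (SimpleGraph.ends Γ) LE k
    l≡vE : l ≡ v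
    l≡vE = ≡.sym (edgeVertex-joins Γ LG k-joins)

theorem4p32 : ∀ {c ℓ : Level} (G : Group c ℓ) → let open GPhase G in
    ∀ (n m : ℕ) (Γ : SimpleGraph n m) → Connected Γ → m ≥ 1 →
    ∀ (s₁ s₂ : C) → Central s₁ → Central s₂ → s₁ ∙ s₁ ≈ ε → s₂ ∙ s₂ ≈ ε →
    ∀ (q : ℕ) (LE : Ends m q) → LineGraphEnum Γ q LE →
    ∀ (H : Phase n m) (g : Fin m → C) (f : Fin n → C) →
      PhaseEq LE (Lmap (SimpleGraph.ends Γ) LE (H ·diag g))
                 (diag* g · Lmap (SimpleGraph.ends Γ) LE H)
      × (∃[ f′ ] PhaseEq LE (Lmap (SimpleGraph.ends Γ) LE (diag* f · H))
                            (Lmap (SimpleGraph.ends Γ) LE H ·diag f′))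
      × (∀ (i j : Fin m) (k : Fin q) → Joins LE k i j →
           ΨL (SimpleGraph.ends Γ) s₂ H i j
             ≈ s₁ ∙ s₂ ∙ Ψ s₁ (Lmap (SimpleGraph.ends Γ) LE H) i j k)
theorem4p32 G n m Γ _ _ s₁ s₂ _ s₂-central s₁²≈ε _ q LE LG H g f =
    Lmap-·diag G ends LE H g
  , (_ , Lmap-diag* G ends LE H f)
  , λ i j k → ΨL≈Ψ-Lmap G Γ LG s₂-central s₁²≈ε H
  where
  ends = SimpleGraph.ends Γ
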